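{- Let $k\geq 1$, $1\leq d\leq k$ and $n\geq 1$. Consider the board with $k+d-1$ rows and $n$ columns, and let $G$ be the conflict graph whose vertices are all possible placements on this board of a $k\times 2$ rectangular tile ($k$ rows, $2$ columns) lying fully inside the board, two distinct placements being adjacent if and only if they share a cell. Then $G$ is claw-free, i.e.\ $G$ has no induced subgraph isomorphic to $K_{1,3}$. -}

module Defs where

open import Data.Nat using (ℕ; _+_; _∸_; _≤_; _<_)
open import Data.Product using (_×_; Σ; ∃; _,_)
open import Relation.Binary.PropositionalEquality using (_≡_)
open import Relation.Nullary using (¬_)

-- A placement of a (k rows × 2 columns) tile on a board with R rows and
-- n columns, given by the 0-indexed position of its top-left cell,
-- lying fully inside the board.
record Placement (k R n : ℕ) : Set where
  constructor place
  field
    row    : ℕ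
    col    : ℕ
    rowFit : row + k ≤ R
    colFit : col + 2 ≤ n
open Placement public

Covers : ∀ {k R n} → Placement k R n → ℕ → ℕ → Set
Covers {k} p i j = (row p ≤ i × i < row p + k) × (col p ≤ j × j < col p + 2)

-- Two placements are the same vertex iff they have the same position.
SamePos : ∀ {k R n} → Placement k R n → Placement k R n → Set
SamePos p q = (row p ≡ row q) × (col p ≡ col q)

Adj : ∀ {k R n} → Placement k R n → Placement k R n → Set
Adj p q = ¬ SamePos p q × ∃ λ i → ∃ λ j → Covers p i j × Covers q i j

InducedClaw : ∀ {k R n} → Placement k R n → Placement k R n
            → Placement k R n → Placement k R n → Set
InducedClaw v a b c =
  (Adj v a × Adj v b × Adj v c)
  × (¬ SamePos a b × ¬ SamePos a c × ¬ SamePos b c)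
  × (¬ Adj a b × ¬ Adj a c × ¬ Adj b c)

ClawFree : ℕ → ℕ → ℕ → Set
ClawFree k R n = ∀ (v a b c : Placement k R n) → ¬ InducedClaw v a b c

{-# OPTIONS --safe #-}
module Submission where

-- A board with fewer than 2k rows is so short that every k-row
-- tile starts above row k, hence covers row k - 1: any two tiles share a row,
-- and two distinct tiles conflict iff their columns differ by at most 1.
-- The leaves of a claw centred at column v therefore lie in the window
-- {v - 1, v, v + 1} with pairwise column distance at least 2.  None can sit
-- at v, which is within 1 of the whole window, so three leaves share the two
-- outer columns and two of them coincide in column, a contradiction.

open import Defs
open import Data.Nat using (ℕ; suc; _+_; _∸_; _≤_; _<_; z≤n; s≤s)
open import Data.Nat.Properties
  using (≤-refl; ≤-antisym; ≤-total; ≤-<-trans; <-≤-trans; m<1+n⇒m≤n; m≤n⇒m<n∨m≡n;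
         +-comm; +-suc; +-monoʳ-<; +-cancelʳ-<; m≤n+m; m<m+n)
open import Data.Product using (_×_; _,_; ∃; swap)
open import Data.Sum using (_⊎_; inj₁; inj₂)
open import Data.Empty using (⊥; ⊥-elim)
open import Function using (_∘_)
open import Relation.Binary.PropositionalEquality using (_≡_; refl; sym; subst)
open import Relation.Nullary using (¬_)

Overlap : ℕ → ℕ → ℕ → ℕ → Set
Overlap a m b l = a < b + l × b < a + m

shared-point⇒overlap : ∀ {a m b l i} → a ≤ i × i < a + m → b ≤ i × i < b + l
                     → Overlap a m b l
shared-point⇒overlap (a≤i , i<a+m) (b≤i , i<b+l) = ≤-<-trans a≤i i<b+l , ≤-<-trans b≤i i<a+m

overlap⇒shared-point : ∀ {a m b l} → 0 < m → 0 < l → Overlap a m b l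
                     → ∃ λ i → (a ≤ i × i < a + m) × (b ≤ i × i < b + l)
overlap⇒shared-point {a} {m} {b} {l} 0<m 0<l (a<b+l , b<a+m) with ≤-total a b
... | inj₁ a≤b = b , (a≤b , b<a+m) , (≤-refl , m<m+n b 0<l)
... | inj₂ b≤a = a , (≤-refl , m<m+n a 0<m) , (b≤a , a<b+l)

Near : ℕ → ℕ → Set
Near x y = Overlap x 2 y 2

near-refl : ∀ x → Near x x
near-refl x = m<m+n x (s≤s z≤n) , m<m+n x (s≤s z≤n)

near-sym : ∀ {x y} → Near x y → Near y x
near-sym = swap

Side : ℕ → ℕ → Set
Side v x = suc x ≡ v ⊎ suc v ≡ x

near⇒≤suc : ∀ {x y} → Near x y → y ≤ suc x
near⇒≤suc {x} {y} (_ , y<x+2) = m<1+n⇒m≤n (subst (y <_) (+-comm x 2) y<x+2)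

near⇒centre⊎side : ∀ {v x} → Near v x → x ≡ v ⊎ Side v x
near⇒centre⊎side vx with m≤n⇒m<n∨m≡n (near⇒≤suc vx)
... | inj₂ x≡1+v = inj₂ (inj₂ (sym x≡1+v))
... | inj₁ (s≤s x≤v) with m≤n⇒m<n∨m≡n x≤v
...   | inj₂ x≡v = inj₁ x≡v
...   | inj₁ x<v = inj₂ (inj₁ (≤-antisym x<v (near⇒≤suc (near-sym vx))))

side-pigeonhole : ∀ {v a b c} → Side v a → Side v b → Side v c → a ≡ b ⊎ a ≡ c ⊎ b ≡ c
side-pigeonhole (inj₁ refl) (inj₁ refl) _           = inj₁ refl
side-pigeonhole (inj₂ refl) (inj₂ refl) _           = inj₁ refl
side-pigeonhole (inj₁ refl) (inj₂ refl) (inj₁ refl) = inj₂ (inj₁ refl)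
side-pigeonhole (inj₁ refl) (inj₂ refl) (inj₂ refl) = inj₂ (inj₂ refl)
side-pigeonhole (inj₂ refl) (inj₁ refl) (inj₁ refl) = inj₂ (inj₂ refl)
side-pigeonhole (inj₂ refl) (inj₁ refl) (inj₂ refl) = inj₂ (inj₁ refl)

far-from-near⇒side : ∀ {v x y} → Near v x → Near v y → ¬ Near x y → Side v x
far-from-near⇒side vx vy ¬xy with near⇒centre⊎side vx
... | inj₁ refl = ⊥-elim (¬xy vy)
... | inj₂ side = side

no-far-triple-near : ∀ {v a b c} → Near v a → Near v b → Near v c
                   → ¬ Near a b → ¬ Near a c → ¬ Near b c → ⊥
no-far-triple-near va vb vc ¬ab ¬ac ¬bc
  with side-pigeonhole (far-from-near⇒side va vb ¬ab)
                       (far-from-near⇒side vb vc ¬bc)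
                       (far-from-near⇒side vc va (¬ac ∘ near-sym))
... | inj₁ refl        = ¬ab (near-refl _)
... | inj₂ (inj₁ refl) = ¬ac (near-refl _)
... | inj₂ (inj₂ refl) = ¬bc (near-refl _)

row<k : ∀ {k R n} → R < k + k → (p : Placement k R n) → row p < k
row<k {k} R<2k p = +-cancelʳ-< k (row p) k (≤-<-trans (rowFit p) R<2k)

adj⇒near-cols : ∀ {k R n} (p q : Placement k R n) → Adj p q → Near (col p) (col q)
adj⇒near-cols _ _ (_ , _ , _ , (_ , p∋j) , (_ , q∋j)) = shared-point⇒overlap p∋j q∋j

module _ {k R n : ℕ} (R<2k : R < k + k) where

  rows-overlap : (p q : Placement k R n) → Overlap (row p) k (row q) k
  rows-overlap p q = <-≤-trans (row<k R<2k p) (m≤n+m k (row q))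
                   , <-≤-trans (row<k R<2k q) (m≤n+m k (row p))

  near-cols⇒adj : (p q : Placement k R n) → ¬ SamePos p q → Near (col p) (col q) → Adj p q
  near-cols⇒adj p q p≢q near =
    let i , p∋i , q∋i = overlap⇒shared-point 0<k 0<k (rows-overlap p q)
        j , p∋j , q∋j = overlap⇒shared-point 0<2 0<2 near
    in  p≢q , i , j , (p∋i , p∋j) , (q∋i , q∋j)
    where
      0<k : 0 < k
      0<k = ≤-<-trans z≤n (row<k R<2k p)
      0<2 : 0 < 2
      0<2 = s≤s z≤n

  far-cols : (p q : Placement k R n) → ¬ SamePos p q → ¬ Adj p q → ¬ Near (col p) (col q)
  far-cols p q p≢q ¬pq = ¬pq ∘ near-cols⇒adj p q p≢q

  short-board-clawFree : ClawFree k R n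
  short-board-clawFree v a b c ((va , vb , vc) , (a≢b , a≢c , b≢c) , (¬ab , ¬ac , ¬bc)) =
    no-far-triple-near (adj⇒near-cols v a va) (adj⇒near-cols v b vb) (adj⇒near-cols v c vc)
      (far-cols a b a≢b ¬ab) (far-cols a c a≢c ¬ac) (far-cols b c b≢c ¬bc)

lemma4p8 : (k d n : ℕ) → 1 ≤ k → 1 ≤ d → d ≤ k → 1 ≤ n
         → ClawFree k (k + d ∸ 1) n
lemma4p8 k (suc d-1) _ _ _ d≤k _ = short-board-clawFree rows<2k
  where
    rows<2k : k + suc d-1 ∸ 1 < k + k
    rows<2k = subst (λ m → m ∸ 1 < k + k) (sym (+-suc k d-1)) (+-monoʳ-< k d≤k)
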